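{- Let $n \geq 5$ and let $G = CS_{4,n-4}$ be the cycle-star graph with cycle length $k=4$ and $n-k \geq 1$ pendant vertices. Then $es(G) = n-2$.
   Context: For integers $k \geq 3$ and $n > k$, the cycle-star graph $CS_{k,n-k}$ is the simple graph on $n$ vertices consisting of a cycle of length $k$ together with $n-k$ additional vertices of degree one (leaves), all adjacent to the same single vertex of the cycle. For a simple graph $G$, a vertex $k$-labeling is a map $\phi: V(G) \to \{1,2,\ldots,k\}$; the weight of an edge $uv$ is $w_\phi(uv) = \phi(u)+\phi(v)$. The labeling is an edge irregular $k$-labeling if distinct edges have distinct weights. The edge irregularity strength $es(G)$ is the minimum $k$ for which $G$ admits an edge irregular $k$-labeling. -}

module Defs where

open import Data.Nat using (ℕ; zero; suc; _+_; _∸_; _≤_; _<_)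
open import Data.Product using (_×_; _,_; Σ)
open import Data.List using (List; []; _∷_; map; _++_; upTo; applyUpTo)
open import Data.List.Relation.Unary.Unique.Propositional using (Unique)
open import Relation.Nullary using (¬_)

-- A finite simple graph: vertices are 0,…,order-1; edges are listed
-- (each edge exactly once) as pairs of vertex indices.
record Graph : Set where
  constructor mkGraph
  field
    order : ℕ
    edges : List (ℕ × ℕ)
open Graph public

-- Cycle-star graph CS_{k,m} on n = k + m vertices:
-- cycle 0 - 1 - … - (k-1) - 0, and leaves k, …, k+m-1 all adjacent to vertex 0.
CS : (k m : ℕ) → Graph
CS k m = mkGraph (k + m)
  ( applyUpTo (λ i → (i , suc i)) (k ∸ 1)
  ++ ((k ∸ 1 , 0) ∷ [])
  ++ applyUpTo (λ j → (0 , k + j)) m )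

IsLabeling : (G : Graph) (k : ℕ) (φ : ℕ → ℕ) → Set
IsLabeling G k φ = ∀ v → v < order G → 1 ≤ φ v × φ v ≤ k

weight : (φ : ℕ → ℕ) → ℕ × ℕ → ℕ
weight φ (u , v) = φ u + φ v

-- Edge irregular k-labeling: distinct edges get distinct weights
-- (edges are listed without repetition, so: the weight list has no duplicates).
IsEdgeIrregularLabeling : (G : Graph) (k : ℕ) (φ : ℕ → ℕ) → Set
IsEdgeIrregularLabeling G k φ = IsLabeling G k φ × Unique (map (weight φ) (edges G))

HasEdgeIrregularLabeling : Graph → ℕ → Set
HasEdgeIrregularLabeling G k = Σ (ℕ → ℕ) (λ φ → IsEdgeIrregularLabeling G k φ)

EdgeIrregularityStrength : Graph → ℕ → Set
EdgeIrregularityStrength G s =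
  HasEdgeIrregularLabeling G s × (∀ k → k < s → ¬ HasEdgeIrregularLabeling G k)

-- Vertex 0 of CS_{4,m} is adjacent to the two cycle vertices 1 and 3 and to
-- all m leaves.  The m + 2 edges at vertex 0 have weights φ 0 + φ v, so an
-- edge irregular labeling is injective on these m + 2 neighbours and needs
-- at least m + 2 labels.  Conversely, for m ≥ 1 label vertex 0 by 1, the
-- leaves by 1, …, m and the cycle vertices 1, 2, 3 by m + 1, m + 2, m + 2:
-- the leaf edges get the weights 2, …, m + 1 and the cycle edges the four
-- distinct weights m + 2, 2m + 3, 2m + 4, m + 3.
module Submission where

open import Defs
open import Data.Nat using (ℕ; suc; pred; _+_; _∸_; _≤_; _<_; s≤s; z≤n; z<s)
open import Data.Nat.Properties
open import Data.Fin using (Fin; toℕ; fromℕ<)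
import Data.Fin.Properties as Fin
open import Data.Product using (_×_; _,_)
open import Data.List using (List; []; _∷_; map; applyUpTo)
open import Data.List.Properties using (map-applyUpTo)
open import Data.List.Membership.Propositional using (_∈_)
open import Data.List.Membership.Propositional.Properties using (∈-map⁺; ∈-applyUpTo⁺)
open import Data.List.Relation.Unary.All as All using (All; []; _∷_)
import Data.List.Relation.Unary.All.Properties as All
open import Data.List.Relation.Unary.AllPairs using ([]; _∷_)
open import Data.List.Relation.Unary.Any using (here; there)
open import Data.List.Relation.Unary.Unique.Propositional using (Unique)
import Data.List.Relation.Unary.Unique.Propositional.Properties as Unique
open import Data.List.Relation.Binary.Disjoint.Propositional using (Disjoint)
open import Relation.Binary.PropositionalEquality
open import Relation.Nullary using (contradiction)
open import Function using (_∘_)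

unique-map⇒injective-∈ : {A B : Set} {f : A → B} {xs : List A} {x y : A} →
                         Unique (map f xs) → x ∈ xs → y ∈ xs → f x ≡ f y → x ≡ y
unique-map⇒injective-∈ {xs = _ ∷ _} _ (here refl) (here refl) _ = refl
unique-map⇒injective-∈ {f = f} {_ ∷ _} (fx≢ ∷ _) (here refl) (there y∈) fx≡fy =
  contradiction fx≡fy (All.lookup fx≢ (∈-map⁺ f y∈))
unique-map⇒injective-∈ {f = f} {_ ∷ _} (fy≢ ∷ _) (there x∈) (here refl) fx≡fy =
  contradiction (sym fx≡fy) (All.lookup fy≢ (∈-map⁺ f x∈))
unique-map⇒injective-∈ {xs = _ ∷ _} (_ ∷ unique) (there x∈) (there y∈) =
  unique-map⇒injective-∈ unique x∈ y∈

bounded-below-above⇒disjoint : ∀ {t xs ys} → All (t ≤_) xs → All (_< t) ys → Disjoint xs ys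
bounded-below-above⇒disjoint t≤xs ys<t (v∈xs , v∈ys) =
  <⇒≱ (All.lookup ys<t v∈ys) (All.lookup t≤xs v∈xs)

injective-labels⇒≤ : ∀ {d k} (g : ℕ → ℕ) →
                     (∀ {i} → i < d → 1 ≤ g i × g i ≤ k) →
                     (∀ {i j} → i < d → j < d → g i ≡ g j → i ≡ j) →
                     d ≤ k
injective-labels⇒≤ {d} {k} g bounded injective = Fin.injective⇒≤ shifted-injective
  where
  pred-label< : ∀ {x} → 1 ≤ x × x ≤ k → pred x < k
  pred-label< (s≤s z≤n , x≤k) = x≤k

  pred-label-injective : ∀ {x y} → 1 ≤ x × x ≤ k → 1 ≤ y × y ≤ k → pred x ≡ pred y → x ≡ y
  pred-label-injective (s≤s z≤n , _) (s≤s z≤n , _) = cong suc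

  shifted : Fin d → Fin k
  shifted i = fromℕ< (pred-label< (bounded (Fin.toℕ<n i)))

  shifted-injective : ∀ {i j} → shifted i ≡ shifted j → i ≡ j
  shifted-injective {i} {j} eq = Fin.toℕ-injective
    (injective (Fin.toℕ<n i) (Fin.toℕ<n j)
      (pred-label-injective (bounded (Fin.toℕ<n i)) (bounded (Fin.toℕ<n j))
        (begin
          pred (g (toℕ i))  ≡⟨ Fin.toℕ-fromℕ< _ ⟨
          toℕ (shifted i)   ≡⟨ cong toℕ eq ⟩
          toℕ (shifted j)   ≡⟨ Fin.toℕ-fromℕ< _ ⟩
          pred (g (toℕ j))  ∎)))
    where open ≡-Reasoning

hubNeighbour : ℕ → ℕ
hubNeighbour 0             = 1
hubNeighbour 1             = 3
hubNeighbour (suc (suc j)) = 4 + j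

hubEdge : ℕ → ℕ × ℕ
hubEdge 0             = (0 , 1)
hubEdge 1             = (3 , 0)
hubEdge (suc (suc j)) = (0 , 4 + j)

hubNeighbour-< : ∀ {m i} → i < 2 + m → hubNeighbour i < order (CS 4 m)
hubNeighbour-< {i = 0}           _                 = s≤s (s≤s z≤n)
hubNeighbour-< {i = 1}           _                 = s≤s (s≤s (s≤s (s≤s z≤n)))
hubNeighbour-< {i = suc (suc j)} (s≤s (s≤s j<m)) = s≤s (s≤s (s≤s (s≤s j<m)))

hubEdge-∈ : ∀ {m i} → i < 2 + m → hubEdge i ∈ edges (CS 4 m)
hubEdge-∈ {i = 0}           _                 = here refl
hubEdge-∈ {i = 1}           _                 = there (there (there (here refl)))
hubEdge-∈ {i = suc (suc j)} (s≤s (s≤s j<m)) =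
  there (there (there (there (∈-applyUpTo⁺ (λ j → (0 , 4 + j)) j<m))))

hubEdge-weight : ∀ φ i → weight φ (hubEdge i) ≡ φ 0 + φ (hubNeighbour i)
hubEdge-weight φ 0             = refl
hubEdge-weight φ 1             = +-comm (φ 3) (φ 0)
hubEdge-weight φ (suc (suc j)) = refl

hubEdge-injective : ∀ {i j} → hubEdge i ≡ hubEdge j → i ≡ j
hubEdge-injective {0}           {0}           _    = refl
hubEdge-injective {0}           {1}           ()
hubEdge-injective {0}           {suc (suc _)} ()
hubEdge-injective {1}           {0}           ()
hubEdge-injective {1}           {1}           _    = refl
hubEdge-injective {1}           {suc (suc _)} ()
hubEdge-injective {suc (suc _)} {0}           ()
hubEdge-injective {suc (suc _)} {1}           ()
hubEdge-injective {suc (suc _)} {suc (suc _)} refl = refl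

edgeIrregular⇒2+m≤k : ∀ {m k φ} → IsEdgeIrregularLabeling (CS 4 m) k φ → 2 + m ≤ k
edgeIrregular⇒2+m≤k {φ = φ} (isLabeling , unique) =
  injective-labels⇒≤ (φ ∘ hubNeighbour)
    (λ {i} i< → isLabeling (hubNeighbour i) (hubNeighbour-< i<))
    (λ {i} {j} i< j< φi≡φj → hubEdge-injective
      (unique-map⇒injective-∈ unique (hubEdge-∈ i<) (hubEdge-∈ j<)
        (hub-weights-≡ {i} {j} φi≡φj)))
  where
  open ≡-Reasoning
  hub-weights-≡ : ∀ {i j} → φ (hubNeighbour i) ≡ φ (hubNeighbour j) →
                  weight φ (hubEdge i) ≡ weight φ (hubEdge j)
  hub-weights-≡ {i} {j} φi≡φj = begin
    weight φ (hubEdge i)        ≡⟨ hubEdge-weight φ i ⟩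
    φ 0 + φ (hubNeighbour i)    ≡⟨ cong (φ 0 +_) φi≡φj ⟩
    φ 0 + φ (hubNeighbour j)    ≡⟨ hubEdge-weight φ j ⟨
    weight φ (hubEdge j)        ∎

-- Edge irregular only for m ≥ 1: for m = 0 the edges 1–2 and 3–0 both get weight 3.
optimalLabel : ℕ → ℕ → ℕ
optimalLabel m 0                         = 1
optimalLabel m 1                         = 1 + m
optimalLabel m 2                         = 2 + m
optimalLabel m 3                         = 2 + m
optimalLabel m (suc (suc (suc (suc j)))) = suc j

optimalLabel-isLabeling : ∀ m → IsLabeling (CS 4 m) (2 + m) (optimalLabel m)
optimalLabel-isLabeling m 0 _ = s≤s z≤n , s≤s z≤n
optimalLabel-isLabeling m 1 _ = s≤s z≤n , n≤1+n _
optimalLabel-isLabeling m 2 _ = s≤s z≤n , ≤-refl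
optimalLabel-isLabeling m 3 _ = s≤s z≤n , ≤-refl
optimalLabel-isLabeling m (suc (suc (suc (suc j)))) (s≤s (s≤s (s≤s (s≤s j<m)))) =
  s≤s z≤n , m≤n⇒m≤1+n (m≤n⇒m≤1+n j<m)

optimalLabel-isEdgeIrregular : ∀ k → IsEdgeIrregularLabeling (CS 4 (suc k)) (3 + k) (optimalLabel (suc k))
optimalLabel-isEdgeIrregular k =
  optimalLabel-isLabeling m ,
  Unique.++⁺ cycle-unique leaf-unique
    (bounded-below-above⇒disjoint {2 + m} cycle-large leaf-small)
  where
  m : ℕ
  m = suc k
  φ : ℕ → ℕ
  φ = optimalLabel m
  leafEdge : ℕ → ℕ × ℕ
  leafEdge j = (0 , 4 + j)

  w01 w12 w23 w30 : ℕ
  w01 = 2 + m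
  w12 = (1 + m) + (2 + m)
  w23 = (2 + m) + (2 + m)
  w30 = (2 + m) + 1

  w01<w30 : w01 < w30
  w01<w30 = m<m+n w01 z<s
  w30<w12 : w30 < w12
  w30<w12 = subst (_< w12) (+-comm 1 w01) (+-monoˡ-< w01 (s≤s (s≤s z≤n)))
  w12<w23 : w12 < w23
  w12<w23 = +-monoˡ-< w01 (n<1+n (1 + m))

  w01<w12 : w01 < w12
  w01<w12 = <-trans w01<w30 w30<w12
  w01<w23 : w01 < w23
  w01<w23 = <-trans w01<w12 w12<w23
  w30<w23 : w30 < w23
  w30<w23 = <-trans w30<w12 w12<w23

  cycle-unique : Unique (w01 ∷ w12 ∷ w23 ∷ w30 ∷ [])
  cycle-unique = (<⇒≢ w01<w12 ∷ <⇒≢ w01<w23 ∷ <⇒≢ w01<w30 ∷ [])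
               ∷ (<⇒≢ w12<w23 ∷ ≢-sym (<⇒≢ w30<w12) ∷ [])
               ∷ (≢-sym (<⇒≢ w30<w23) ∷ [])
               ∷ []
               ∷ []

  cycle-large : All (w01 ≤_) (w01 ∷ w12 ∷ w23 ∷ w30 ∷ [])
  cycle-large = ≤-refl ∷ <⇒≤ w01<w12 ∷ <⇒≤ w01<w23 ∷ <⇒≤ w01<w30 ∷ []

  leaf-weights : map (weight φ) (applyUpTo leafEdge m) ≡ applyUpTo (2 +_) m
  leaf-weights = map-applyUpTo leafEdge (weight φ) m

  leaf-unique : Unique (map (weight φ) (applyUpTo leafEdge m))
  leaf-unique = subst Unique (sym leaf-weights)
    (Unique.applyUpTo⁺₁ (2 +_) m (λ i<j _ → <⇒≢ (s≤s (s≤s i<j))))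

  leaf-small : All (_< w01) (map (weight φ) (applyUpTo leafEdge m))
  leaf-small = subst (All (_< w01)) (sym leaf-weights)
    (All.applyUpTo⁺₁ (2 +_) m (λ j<m → s≤s (s≤s j<m)))

theorem3p3 : (n : ℕ) → 5 ≤ n → EdgeIrregularityStrength (CS 4 (n ∸ 4)) (n ∸ 2)
theorem3p3 (suc (suc (suc (suc (suc k))))) (s≤s (s≤s (s≤s (s≤s (s≤s _))))) =
  (optimalLabel (suc k) , optimalLabel-isEdgeIrregular k) ,
  λ k' k'<n-2 (_ , irregular) → <⇒≱ k'<n-2 (edgeIrregular⇒2+m≤k irregular)
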